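{- For any finite word $w$, the maximum size of an independent cycle set of the multigraph $\Gamma_w$ is $|w|$.
   Context: For a word $w$, $F(w)$ is the set of its factors (including the empty word $\varepsilon$) and $F_w(\ell)$ the set of factors of length $\ell$. The Rauzy graph $\Gamma_w(\ell)$ of order $\ell\in\{0,\dots,|w|\}$ is the directed multigraph with vertex set $F_w(\ell)$ and arc set $F_w(\ell+1)$, where an arc $u$ goes from vertex $u[1..\ell]$ to vertex $u[2..\ell+1]$ (loops and parallel arcs allowed). $\Gamma_w$ is the disjoint union of $\Gamma_w(0),\dots,\Gamma_w(|w|)$: vertex set $F(w)$, arc set $F(w)\setminus\{\varepsilon\}$, vertices and arcs being distinct objects. A cycle is a closed chain in the underlying undirected multigraph. If the arcs are $u_1,\dots,u_{N}$, the cycle-vector of a cycle $C$ is $\mu(C)=(c_1,\dots,c_N)$, where $c_i$ is the number of traversals of $u_i$ in its own direction minus the number in the opposite direction. A set of cycles is independent if their cycle-vectors are linearly independent. -}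

module Defs where

open import Data.List using (List; []; _∷_; _++_; length)
open import Data.List.Relation.Unary.All using (All)
open import Data.Bool using (Bool; true; false)
open import Data.Product using (Σ; _×_; _,_; proj₁)
open import Data.Fin using (Fin; zero; suc)
open import Data.Nat using (ℕ)
open import Data.Integer using (ℤ; _+_; _-_; _*_; 0ℤ; 1ℤ)
open import Relation.Binary.PropositionalEquality using (_≡_; _≢_)
open import Relation.Binary.Definitions using (DecidableEquality)
open import Relation.Nullary using (yes; no)

Factor : {A : Set} → List A → List A → Set
Factor u w = Σ _ λ p → Σ _ λ s → p ++ (u ++ s) ≡ w

dropLast : {A : Set} → List A → List A
dropLast []           = []
dropLast (x ∷ [])     = []
dropLast (x ∷ y ∷ r)  = x ∷ dropLast (y ∷ r)

dropFirst : {A : Set} → List A → List A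
dropFirst []      = []
dropFirst (x ∷ r) = r

src tgt : {A : Set} → List A → List A
src = dropLast
tgt = dropFirst

-- A step of a chain: an arc together with the traversal direction
-- (true = in its own direction, false = against it).
Step : Set → Set
Step A = List A × Bool

Chain : {A : Set} → List A → List (Step A) → List A → Set
Chain x []                  y = x ≡ y
Chain x ((u , true)  ∷ st)  y = src u ≡ x × Chain (tgt u) st y
Chain x ((u , false) ∷ st)  y = tgt u ≡ x × Chain (src u) st y

IsArc : {A : Set} → List A → List A → Set
IsArc w u = Factor u w × u ≢ []

record Cycle {A : Set} (w : List A) : Set where
  field
    start    : List A
    startOK  : Factor start w
    steps    : List (Step A)
    arcsOK   : All (λ s → IsArc w (proj₁ s)) steps
    closed   : Chain start steps start
open Cycle public

count : {A : Set} → DecidableEquality (List A) → List A → List (Step A) → ℤ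
count _≟_ u [] = 0ℤ
count _≟_ u ((v , d) ∷ st) with u ≟ v | d
... | yes _ | true  = 1ℤ + count _≟_ u st
... | yes _ | false = count _≟_ u st - 1ℤ
... | no _  | _     = count _≟_ u st

μ : {A : Set} → DecidableEquality (List A) → {w : List A} → Cycle w → List A → ℤ
μ _≟_ C u = count _≟_ u (steps C)

sumFin : (k : ℕ) → (Fin k → ℤ) → ℤ
sumFin ℕ.zero    f = 0ℤ
sumFin (ℕ.suc k) f = f zero + sumFin k (λ i → f (suc i))

-- A family C_1..C_k of cycles is independent if their cycle-vectors
-- (indexed by the arcs of Γ_w) are linearly independent (over ℤ,
-- equivalently over ℚ).
Independent : {A : Set} → DecidableEquality (List A) → {w : List A} →
              {k : ℕ} → (Fin k → Cycle w) → Set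
Independent _≟_ {w} {k} C =
  (c : Fin k → ℤ) →
  (∀ u → IsArc w u → sumFin k (λ i → c i * μ _≟_ (C i) u) ≡ 0ℤ) →
  ∀ i → c i ≡ 0ℤ

-- Build the word from the right, w ↦ x ∷ w. The arcs of Γ (x ∷ w) that are not arcs of Γ w are the
-- prefixes of x ∷ w that do not occur in w. The shortest of them, s, joins two old vertices and so
-- closes a cycle with the old arcs; every longer one is the only arc at its (new) source vertex.
-- Hence the cycles obtained this way have a triangular pattern of s-coordinates and are independent,
-- which gives |w| independent cycles. Conversely, on the arcs of Γ w every indicator function of an
-- arc is an integer combination of the indicators of these |w| arcs s plus a coboundary δ g; since
-- coboundaries integrate to zero along closed chains, every cycle-vector is determined by its |w|
-- coordinates at the arcs s, and more than |w| vectors in ℤ^|w| are linearly dependent.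

module Submission where

open import Algebra.Definitions.RawMagma using (module _∣ˡ_)
open import Data.Bool using (Bool; true; false)
open import Data.Empty using (⊥-elim)
open import Data.Fin using (Fin; zero; suc; punchIn)
open import Data.Fin.Properties using (all?; ¬∀⟶∃¬)
open import Data.Integer
  using (ℤ; _+_; _-_; _*_; -_; 0ℤ; 1ℤ; -1ℤ) renaming (_≟_ to _≟ℤ_)
open import Data.Integer.Properties
  using ( +-*-semiring; *-zeroʳ; *-zeroˡ; *-assoc; +-identityʳ; +-identityˡ; +-inverseʳ; +-comm
        ; i*j≡0⇒i≡0∨j≡0)
open import Data.Integer.Tactic.RingSolver using (solve-∀)
open import Data.List using (List; []; _∷_; _++_; length; take; drop)
open import Data.List.Properties
  using ( ≡-dec; ++-assoc; ++-identityʳ; ∷-injectiveʳ; length-++-≤ˡ; length-++-≤ʳ; length-take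
        ; take-take; take-all; take++drop≡id)
open import Data.List.Relation.Binary.Infix.Heterogeneous using (Infix; here; there)
open import Data.List.Relation.Binary.Infix.Heterogeneous.Properties using (infix?)
open import Data.List.Relation.Binary.Prefix.Propositional.Properties using (Prefix-as-∣ˡ; ∣ˡ-as-Prefix)
open import Data.List.Relation.Unary.All using (All; []; _∷_)
import Data.List.Relation.Unary.All as All
open import Data.Nat using (ℕ; zero; suc; _≤_; _<_; s≤s; _≤?_)
open import Data.Nat.Properties
  using (≤-refl; ≤-trans; ≤-reflexive; ≤-antisym; ≰⇒>; m<n⇒m<1+n; m≤n⇒m⊓n≡m; m⊓n≤m; 1+n≰n)
open import Data.Product using (Σ; ∃; _×_; _,_; proj₁; proj₂; map₁)
open import Data.Sum using (_⊎_; inj₁; inj₂)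
import Data.Vec.Functional as Vector
open import Data.Vec.Functional using (insertAt)
open import Data.Vec.Functional.Properties using (insertAt-lookup; insertAt-punchIn)
open import Function using (_∘_; const)
open import Relation.Binary.Definitions using (DecidableEquality)
open import Relation.Binary.PropositionalEquality
  using (_≡_; _≢_; refl; sym; trans; cong; cong₂; subst; module ≡-Reasoning)
open import Relation.Nullary using (¬_; Dec; yes; no)
open import Relation.Nullary.Decidable using (map′)
open import Relation.Unary using (Decidable)
open import Algebra.Properties.Semiring.Sum +-*-semiring
  using (sum; sum-cong-≗; sum-replicate-zero; sum-remove; ∑-distrib-+; ∑-comm; *-distribˡ-sum)

open import Defs

sumFin≡sum : ∀ k (f : Fin k → ℤ) → sumFin k f ≡ sum f
sumFin≡sum zero    f = refl
sumFin≡sum (suc k) f = cong (f zero +_) (sumFin≡sum k (f ∘ suc))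

sum-zero : ∀ {n} {f : Fin n → ℤ} → (∀ i → f i ≡ 0ℤ) → sum f ≡ 0ℤ
sum-zero {n} f≗0 = trans (sum-cong-≗ f≗0) (sum-replicate-zero n)

sumFin-zero : ∀ k {f : Fin k → ℤ} → (∀ i → f i ≡ 0ℤ) → sumFin k f ≡ 0ℤ
sumFin-zero k {f} f≗0 = trans (sumFin≡sum k f) (sum-zero f≗0)

NontrivialRelation : ∀ {k n} → (Fin k → Fin n → ℤ) → (Fin k → ℤ) → Set
NontrivialRelation V c = (∃ λ i → c i ≢ 0ℤ) × (∀ j → sum (λ i → c i * V i j) ≡ 0ℤ)

-- Row i of reduced is pivot · (row (punchIn p i)) − V (punchIn p i) 0 · (row p), so a relation among
-- the reduced rows lifts to one among the rows of V.
module Elimination {k n : ℕ} (V : Fin (suc k) → Fin (suc n) → ℤ) (p : Fin (suc k)) where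

  pivot : ℤ
  pivot = V p zero

  reduced : Fin k → Fin n → ℤ
  reduced i j = pivot * V (punchIn p i) (suc j) - V (punchIn p i) zero * V p (suc j)

  lift : (Fin k → ℤ) → Fin (suc k) → ℤ
  lift d = insertAt (λ i → pivot * d i) p (- sum (λ i → d i * V (punchIn p i) zero))

  lift-relation : pivot ≢ 0ℤ → ∀ d → NontrivialRelation reduced d → NontrivialRelation V (lift d)
  lift-relation pivot≢0 d ((i , di≢0) , reduced-rel) = (punchIn p i , lift-nonzero) , rel
    where
    D = sum (λ i → d i * V (punchIn p i) zero)

    lift-nonzero : lift d (punchIn p i) ≢ 0ℤ
    lift-nonzero eq with i*j≡0⇒i≡0∨j≡0 pivot (trans (sym (insertAt-punchIn _ p _ i)) eq)
    ... | inj₁ pivot≡0 = pivot≢0 pivot≡0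
    ... | inj₂ di≡0    = di≢0 di≡0

    split : ∀ j → sum (λ i → lift d i * V i j) ≡ - D * V p j + sum (λ i → pivot * d i * V (punchIn p i) j)
    split j = trans (sum-remove {i = p} (λ i → lift d i * V i j))
      (cong₂ _+_ (cong (_* V p j) (insertAt-lookup _ p _))
                 (sum-cong-≗ (λ i → cong (_* V (punchIn p i) j) (insertAt-punchIn _ p _ i))))

    rel : ∀ j → sum (λ i → lift d i * V i j) ≡ 0ℤ
    rel zero = begin
      sum (λ i → lift d i * V i zero)                          ≡⟨ split zero ⟩
      - D * pivot + sum (λ i → pivot * d i * V (punchIn p i) zero)
        ≡⟨ cong (- D * pivot +_) (sum-cong-≗ (λ i → *-assoc pivot (d i) _)) ⟩
      - D * pivot + sum (λ i → pivot * (d i * V (punchIn p i) zero))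
        ≡⟨ cong (- D * pivot +_) (sym (*-distribˡ-sum pivot (λ i → d i * V (punchIn p i) zero))) ⟩
      - D * pivot + pivot * D                                  ≡⟨ cancel D pivot ⟩
      0ℤ                                                       ∎
      where
      open ≡-Reasoning
      cancel : ∀ x y → - x * y + y * x ≡ 0ℤ
      cancel = solve-∀
    rel (suc j) = begin
      sum (λ i → lift d i * V i (suc j))                       ≡⟨ split (suc j) ⟩
      - D * f + sum (λ i → pivot * d i * X i)                  ≡⟨ swap D f _ ⟩
      sum (λ i → pivot * d i * X i) + - f * D
        ≡⟨ cong (sum (λ i → pivot * d i * X i) +_) (*-distribˡ-sum (- f) (λ i → d i * b i)) ⟩
      sum (λ i → pivot * d i * X i) + sum (λ i → - f * (d i * b i))
        ≡⟨ sym (∑-distrib-+ (λ i → pivot * d i * X i) _) ⟩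
      sum (λ i → pivot * d i * X i + - f * (d i * b i))
        ≡⟨ sum-cong-≗ (λ i → factor-d pivot (d i) (X i) f (b i)) ⟩
      sum (λ i → d i * reduced i j)                            ≡⟨ reduced-rel j ⟩
      0ℤ                                                       ∎
      where
      open ≡-Reasoning
      f = V p (suc j)
      X b : Fin k → ℤ
      X i = V (punchIn p i) (suc j)
      b i = V (punchIn p i) zero
      swap : ∀ x y z → - x * y + z ≡ z + - y * x
      swap = solve-∀
      factor-d : ∀ a d x y b → a * d * x + - y * (d * b) ≡ d * (a * x - b * y)
      factor-d = solve-∀

dependent-rows : ∀ {n k} → n < k → (V : Fin k → Fin n → ℤ) → Σ (Fin k → ℤ) (NontrivialRelation V)
dependent-rows {zero}  {suc k} _         V = const 1ℤ , (zero , λ ()) , λ ()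
dependent-rows {suc n} {suc k} (s≤s n<k) V with all? (λ i → V i zero ≟ℤ 0ℤ)
... | yes column₀≡0 with dependent-rows (m<n⇒m<1+n n<k) (λ i j → V i (suc j))
...   | c , nonzero , rel = c , nonzero , λ
  { zero    → sum-zero (λ i → trans (cong (c i *_) (column₀≡0 i)) (*-zeroʳ (c i)))
  ; (suc j) → rel j }
dependent-rows {suc n} {suc k} (s≤s n<k) V | no column₀≢0
  with ¬∀⟶∃¬ _ _ (λ i → V i zero ≟ℤ 0ℤ) column₀≢0
... | p , pivot≢0 with dependent-rows n<k (Elimination.reduced V p)
...   | d , d-rel = Elimination.lift V p d , Elimination.lift-relation V p pivot≢0 d d-rel

threshold : {P : ℕ → Set} → Decidable P → P 0 → ∀ {n} → ¬ P n → ∃ λ m → P m × ¬ P (suc m)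
threshold P? P₀ {zero}  ¬P₀ = ⊥-elim (¬P₀ P₀)
threshold P? P₀ {suc n} ¬Pₙ₊₁ with P? n
... | yes Pₙ = n , Pₙ , ¬Pₙ₊₁
... | no ¬Pₙ = threshold P? P₀ ¬Pₙ

module _ {A : Set} where

  factor-[] : (w : List A) → Factor [] w
  factor-[] w = [] , w , refl

  prefix⇒factor : {u r w : List A} → u ++ r ≡ w → Factor u w
  prefix⇒factor {r = r} u++r≡w = [] , r , u++r≡w

  factor-∷ : {u w : List A} {x : A} → Factor u w → Factor u (x ∷ w)
  factor-∷ {x = x} (p , r , eq) = x ∷ p , r , cong (x ∷_) eq

  factor-∷⁻ : {u w : List A} {x : A} → Factor u (x ∷ w) → Factor u w ⊎ (∃ λ r → u ++ r ≡ x ∷ w)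
  factor-∷⁻ ([]    , r , eq) = inj₂ (r , eq)
  factor-∷⁻ (_ ∷ p , r , eq) = inj₁ (p , r , ∷-injectiveʳ eq)

  factor-trans : {u v w : List A} → Factor u v → Factor v w → Factor u w
  factor-trans {u} (p , r , refl) (p′ , r′ , refl) = p′ ++ p , r ++ r′ , reassociate
    where
    open ≡-Reasoning
    reassociate : (p′ ++ p) ++ (u ++ (r ++ r′)) ≡ p′ ++ ((p ++ (u ++ r)) ++ r′)
    reassociate = begin
      (p′ ++ p) ++ (u ++ (r ++ r′))   ≡⟨ ++-assoc p′ p _ ⟩
      p′ ++ (p ++ (u ++ (r ++ r′)))   ≡⟨ cong (λ z → p′ ++ (p ++ z)) (++-assoc u r r′) ⟨
      p′ ++ (p ++ ((u ++ r) ++ r′))   ≡⟨ cong (p′ ++_) (++-assoc p (u ++ r) r′) ⟨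
      p′ ++ ((p ++ (u ++ r)) ++ r′)   ∎

  factor-length : {u w : List A} → Factor u w → length u ≤ length w
  factor-length {u} (p , r , refl) = ≤-trans (length-++-≤ˡ u) (length-++-≤ʳ (u ++ r) {p})

  no-arc-[] : {u : List A} → ¬ IsArc [] u
  no-arc-[] {[]}    (_ , u≢[]) = u≢[] refl
  no-arc-[] {_ ∷ _} (u⊑[] , _) with () ← factor-length u⊑[]

  dropLast-prefix : (u : List A) → ∃ λ r → dropLast u ++ r ≡ u
  dropLast-prefix []          = [] , refl
  dropLast-prefix (x ∷ [])    = x ∷ [] , refl
  dropLast-prefix (x ∷ y ∷ u) with r , eq ← dropLast-prefix (y ∷ u) = r , cong (x ∷_) eq

  factor-src : {u w : List A} → Factor u w → Factor (src u) w
  factor-src {u} = factor-trans (prefix⇒factor (proj₂ (dropLast-prefix u)))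

  factor-tgt : {u w : List A} → Factor u w → Factor (tgt u) w
  factor-tgt {[]}    u⊑w = u⊑w
  factor-tgt {x ∷ u} = factor-trans (x ∷ [] , [] , cong (x ∷_) (++-identityʳ u))

  tgt-factor-∷ : {u w : List A} {x : A} → Factor u (x ∷ w) → Factor (tgt u) w
  tgt-factor-∷ {[]}    _                = factor-[] _
  tgt-factor-∷ {_ ∷ u} ([]    , r , eq) = prefix⇒factor (∷-injectiveʳ eq)
  tgt-factor-∷ {_ ∷ u} (_ ∷ p , r , eq) = factor-tgt (p , r , ∷-injectiveʳ eq)

  length-src≡length-tgt : (u : List A) → length (src u) ≡ length (tgt u)
  length-src≡length-tgt []          = refl
  length-src≡length-tgt (x ∷ [])    = refl
  length-src≡length-tgt (x ∷ y ∷ u) = cong suc (length-src≡length-tgt (y ∷ u))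

  length-src : {u : List A} → u ≢ [] → length u ≡ suc (length (src u))
  length-src {[]}    u≢[] = ⊥-elim (u≢[] refl)
  length-src {x ∷ u} _    = cong suc (sym (length-src≡length-tgt (x ∷ u)))

  prefix-take : {u r t : List A} → u ++ r ≡ t → u ≡ take (length u) t
  prefix-take {[]}    _    = refl
  prefix-take {x ∷ u} refl = cong (x ∷_) (prefix-take refl)

  src-prefix : {u r t : List A} → u ++ r ≡ t → ∃ λ r′ → src u ++ r′ ≡ t
  src-prefix {u} {r} refl with dropLast-prefix u
  ... | r₀ , src-u++r₀≡u = r₀ ++ r , trans (sym (++-assoc (src u) r₀ r)) (cong (_++ r) src-u++r₀≡u)

  prefix-∷-tgt : {u r w : List A} {x : A} → u ++ r ≡ x ∷ w → tgt u ≡ take (length (src u)) w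
  prefix-∷-tgt {[]}    _  = refl
  prefix-∷-tgt {y ∷ u} eq =
    trans (prefix-take (∷-injectiveʳ eq)) (cong (λ ℓ → take ℓ _) (sym (length-src≡length-tgt (y ∷ u))))

  take-factor : ∀ {m n} → m ≤ n → (t : List A) → Factor (take m t) (take n t)
  take-factor {m} {n} m≤n t =
    subst (λ v → Factor v (take n t))
          (trans (take-take m n t) (cong (λ k → take k t) (m≤n⇒m⊓n≡m m≤n)))
          (prefix⇒factor (take++drop≡id m (take n t)))

  dropLast-∷-take : ∀ {ℓ} (y : A) (w : List A) → ℓ ≤ length w →
                    dropLast (y ∷ take ℓ w) ≡ take ℓ (y ∷ w)
  dropLast-∷-take {zero}  y w       _         = refl
  dropLast-∷-take {suc ℓ} y (z ∷ w) (s≤s ℓ≤) = cong (y ∷_) (dropLast-∷-take z w ℓ≤)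

module _ {A : Set} (_≟_ : DecidableEquality A) where

  factor? : (u w : List A) → Dec (Factor u w)
  factor? u w = map′ infix⇒factor factor⇒infix (infix? _≟_ u w)
    where
    infix⇒factor : {u w : List A} → Infix _≡_ u w → Factor u w
    infix⇒factor (here u≤w) = prefix⇒factor (_∣ˡ_.equality (Prefix-as-∣ˡ u≤w))
    infix⇒factor (there u⊑w) = factor-∷ (infix⇒factor u⊑w)

    factor⇒infix : {u w : List A} → Factor u w → Infix _≡_ u w
    factor⇒infix ([]    , r , refl) = here (∣ˡ-as-Prefix record { quotient = r ; equality = refl })
    factor⇒infix (_ ∷ p , r , refl) = there (factor⇒infix (p , r , refl))


module _ {A : Set} where

  ArcsIn : List A → List (Step A) → Set
  ArcsIn w = All (λ step → IsArc w (proj₁ step))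

  arcsIn-∷ : {w : List A} {x : A} {st : List (Step A)} → ArcsIn w st → ArcsIn (x ∷ w) st
  arcsIn-∷ = All.map (map₁ factor-∷)

  liftCycle : {w : List A} {x : A} → Cycle w → Cycle (x ∷ w)
  liftCycle C = record
    { start   = start C
    ; startOK = factor-∷ (startOK C)
    ; steps   = steps C
    ; arcsOK  = arcsIn-∷ (arcsOK C)
    ; closed  = closed C
    }

  prefixChain : {v : List A} (w : List A) → Factor v w →
                ∃ λ st → Chain (take (length v) w) st v × ArcsIn w st
  prefixChain {v} _ ([] , r , refl) = [] , sym (prefix-take refl) , []
  prefixChain {v} (y ∷ w) (_ ∷ p , r , eq) with prefixChain w (p , r , ∷-injectiveʳ eq)
  ... | st , chain , arcs =
    (y ∷ take (length v) w , true) ∷ st ,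
    (dropLast-∷-take y w (factor-length (p , r , ∷-injectiveʳ eq)) , chain) ,
    (prefix⇒factor (cong (y ∷_) (take++drop≡id (length v) w)) , λ ()) ∷ arcsIn-∷ arcs

  orientation : Bool → ℤ
  orientation true  = 1ℤ
  orientation false = -1ℤ

  integrate : (List A → ℤ) → List (Step A) → ℤ
  integrate f []             = 0ℤ
  integrate f ((v , d) ∷ st) = orientation d * f v + integrate f st

  δ : (List A → ℤ) → List A → ℤ
  δ g v = g (src v) - g (tgt v)

  integrate-cong : {P : List A → Set} {f h : List A → ℤ} {st : List (Step A)} →
                   All (λ step → P (proj₁ step)) st → (∀ v → P v → f v ≡ h v) →
                   integrate f st ≡ integrate h st
  integrate-cong []                   f≗h = refl
  integrate-cong {st = (v , d) ∷ _} (Pv ∷ Pst) f≗h =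
    cong₂ (λ a b → orientation d * a + b) (f≗h v Pv) (integrate-cong Pst f≗h)

  integrate-+ : (f h : List A → ℤ) (st : List (Step A)) →
                integrate (λ v → f v + h v) st ≡ integrate f st + integrate h st
  integrate-+ f h []             = refl
  integrate-+ f h ((v , d) ∷ st) =
    trans (cong (orientation d * (f v + h v) +_) (integrate-+ f h st))
          (distribute (orientation d) (f v) (h v) (integrate f st) (integrate h st))
    where
    distribute : ∀ σ a b x y → σ * (a + b) + (x + y) ≡ (σ * a + x) + (σ * b + y)
    distribute = solve-∀

  integrate-* : (c : ℤ) (f : List A → ℤ) (st : List (Step A)) →
                integrate (λ v → c * f v) st ≡ c * integrate f st
  integrate-* c f []             = sym (*-zeroʳ c)
  integrate-* c f ((v , d) ∷ st) =
    trans (cong (orientation d * (c * f v) +_) (integrate-* c f st))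
          (distribute (orientation d) c (f v) (integrate f st))
    where
    distribute : ∀ σ c a x → σ * (c * a) + c * x ≡ c * (σ * a + x)
    distribute = solve-∀

  integrate-sum : ∀ {n} (F : Fin n → List A → ℤ) (st : List (Step A)) →
                  integrate (λ v → sum (λ j → F j v)) st ≡ sum (λ j → integrate (F j) st)
  integrate-sum {zero}  F st = integrate-zero st
    where
    integrate-zero : ∀ st → integrate (λ _ → 0ℤ) st ≡ 0ℤ
    integrate-zero []             = refl
    integrate-zero ((_ , d) ∷ st) =
      trans (cong₂ _+_ (*-zeroʳ (orientation d)) (integrate-zero st)) refl
  integrate-sum {suc n} F st =
    trans (integrate-+ (F zero) (λ v → sum (λ j → F (suc j) v)) st)
          (cong (integrate (F zero) st +_) (integrate-sum (F ∘ suc) st))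

  integrate-δ : (g : List A → ℤ) {x y : List A} (st : List (Step A)) → Chain x st y →
                integrate (δ g) st ≡ g x - g y
  integrate-δ g []                refl          = sym (+-inverseʳ (g _))
  integrate-δ g ((u , true)  ∷ st) (refl , chain) =
    trans (cong (1ℤ * δ g u +_) (integrate-δ g st chain)) (telescope (g (src u)) (g (tgt u)) (g _))
    where
    telescope : ∀ a b c → 1ℤ * (a - b) + (b - c) ≡ a - c
    telescope = solve-∀
  integrate-δ g ((u , false) ∷ st) (refl , chain) =
    trans (cong (-1ℤ * δ g u +_) (integrate-δ g st chain)) (telescope (g (src u)) (g (tgt u)) (g _))
    where
    telescope : ∀ a b c → -1ℤ * (a - b) + (a - c) ≡ b - c
    telescope = solve-∀

  integrate-δ-cycle : {w : List A} (g : List A → ℤ) (C : Cycle w) → integrate (δ g) (steps C) ≡ 0ℤ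
  integrate-δ-cycle g C = trans (integrate-δ g (steps C) (closed C)) (+-inverseʳ (g (start C)))

module CycleSpace {A : Set} (_≟_ : DecidableEquality (List A)) where

  𝟙 : List A → List A → ℤ
  𝟙 u v with u ≟ v
  ... | yes _ = 1ℤ
  ... | no  _ = 0ℤ

  𝟙-refl : (u : List A) → 𝟙 u u ≡ 1ℤ
  𝟙-refl u with u ≟ u
  ... | yes _   = refl
  ... | no  u≢u = ⊥-elim (u≢u refl)

  𝟙-≢ : {u v : List A} → u ≢ v → 𝟙 u v ≡ 0ℤ
  𝟙-≢ {u} {v} u≢v with u ≟ v
  ... | yes u≡v = ⊥-elim (u≢v u≡v)
  ... | no  _   = refl

  𝟙-cong-⇔ : {u v u′ v′ : List A} → (u ≡ v → u′ ≡ v′) → (u′ ≡ v′ → u ≡ v) → 𝟙 u v ≡ 𝟙 u′ v′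
  𝟙-cong-⇔ {u} {v} {u′} {v′} to from with u ≟ v | u′ ≟ v′
  ... | yes _   | yes _    = refl
  ... | no  _   | no  _    = refl
  ... | yes u≡v | no  u′≢v′ = ⊥-elim (u′≢v′ (to u≡v))
  ... | no  u≢v | yes u′≡v′ = ⊥-elim (u≢v (from u′≡v′))

  count≡integrate-𝟙 : (u : List A) (st : List (Step A)) → count _≟_ u st ≡ integrate (𝟙 u) st
  count≡integrate-𝟙 u []             = refl
  count≡integrate-𝟙 u ((v , d) ∷ st) with u ≟ v | d
  ... | yes _ | true  = cong (1ℤ +_) (count≡integrate-𝟙 u st)
  ... | yes _ | false = trans (cong (_- 1ℤ) (count≡integrate-𝟙 u st)) (+-comm (integrate (𝟙 u) st) -1ℤ)
  ... | no  _ | true  = trans (count≡integrate-𝟙 u st) (sym (+-identityˡ _))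
  ... | no  _ | false = trans (count≡integrate-𝟙 u st) (sym (+-identityˡ _))

  count-absent : {w u : List A} {st : List (Step A)} → ArcsIn w st → ¬ Factor u w → count _≟_ u st ≡ 0ℤ
  count-absent {u = u} {st = (v , d) ∷ st} ((v⊑w , _) ∷ arcs) u⋢w with u ≟ v | d
  ... | yes refl | _     = ⊥-elim (u⋢w v⊑w)
  ... | no  _    | true  = count-absent arcs u⋢w
  ... | no  _    | false = count-absent arcs u⋢w
  count-absent [] _ = refl

  count-first : (u : List A) (st : List (Step A)) → count _≟_ u ((u , true) ∷ st) ≡ 1ℤ + count _≟_ u st
  count-first u st with u ≟ u
  ... | yes _   = refl
  ... | no  u≢u = ⊥-elim (u≢u refl)

  Decomposition : (w : List A) {n : ℕ} → (Fin n → List A) → List A → Set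
  Decomposition w {n} B u = Σ (Fin n → ℤ) λ a → Σ (List A → ℤ) λ g →
    ∀ v → IsArc w v → 𝟙 u v ≡ sum (λ j → a j * 𝟙 (B j) v) + δ g v

  Spans : (w : List A) {n : ℕ} → (Fin n → List A) → Set
  Spans w B = ∀ u → IsArc w u → Decomposition w B u

  cycle-vector-decomposition :
    {w : List A} {n : ℕ} {B : Fin n → List A} {u : List A} (a : Fin n → ℤ) (g : List A → ℤ) →
    (∀ v → IsArc w v → 𝟙 u v ≡ sum (λ j → a j * 𝟙 (B j) v) + δ g v) →
    (C : Cycle w) → μ _≟_ C u ≡ sum (λ j → a j * μ _≟_ C (B j))
  cycle-vector-decomposition {B = B} {u} a g 𝟙ᵤ≡ C = begin
    count _≟_ u st
      ≡⟨ count≡integrate-𝟙 u st ⟩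
    integrate (𝟙 u) st
      ≡⟨ integrate-cong (arcsOK C) 𝟙ᵤ≡ ⟩
    integrate (λ v → sum (λ j → a j * 𝟙 (B j) v) + δ g v) st
      ≡⟨ integrate-+ (λ v → sum (λ j → a j * 𝟙 (B j) v)) (δ g) st ⟩
    integrate (λ v → sum (λ j → a j * 𝟙 (B j) v)) st + integrate (δ g) st
      ≡⟨ cong₂ _+_ (integrate-sum (λ j v → a j * 𝟙 (B j) v) st) (integrate-δ-cycle g C) ⟩
    sum (λ j → integrate (λ v → a j * 𝟙 (B j) v) st) + 0ℤ
      ≡⟨ +-identityʳ _ ⟩
    sum (λ j → integrate (λ v → a j * 𝟙 (B j) v) st)
      ≡⟨ sum-cong-≗ (λ j → integrate-* (a j) (𝟙 (B j)) st) ⟩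
    sum (λ j → a j * integrate (𝟙 (B j)) st)
      ≡⟨ sum-cong-≗ (λ j → cong (a j *_) (count≡integrate-𝟙 (B j) st)) ⟨
    sum (λ j → a j * count _≟_ (B j) st)
      ∎
    where
    open ≡-Reasoning
    st = steps C

  independent≤spanning : {w : List A} {n : ℕ} {B : Fin n → List A} → Spans w B →
                         (k : ℕ) (C : Fin k → Cycle w) → Independent _≟_ C → k ≤ n
  independent≤spanning {w} {n} {B} spans k C independent with k ≤? n
  ... | yes k≤n = k≤n
  ... | no  k≰n with dependent-rows (≰⇒> k≰n) (λ i j → μ _≟_ (C i) (B j))
  ...   | c , (i , cᵢ≢0) , relation = ⊥-elim (cᵢ≢0 (independent c combination≡0 i))
    where
    V : Fin k → Fin n → ℤ
    V i j = μ _≟_ (C i) (B j)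

    combination≡0 : ∀ u → IsArc w u → sumFin k (λ i → c i * μ _≟_ (C i) u) ≡ 0ℤ
    combination≡0 u u-arc with a , g , 𝟙ᵤ≡ ← spans u u-arc = begin
      sumFin k (λ i → c i * μ _≟_ (C i) u)
        ≡⟨ sumFin≡sum k _ ⟩
      sum (λ i → c i * μ _≟_ (C i) u)
        ≡⟨ sum-cong-≗ (λ i → cong (c i *_) (cycle-vector-decomposition a g 𝟙ᵤ≡ (C i))) ⟩
      sum (λ i → c i * sum (λ j → a j * V i j))
        ≡⟨ sum-cong-≗ (λ i → *-distribˡ-sum (c i) (λ j → a j * V i j)) ⟩
      sum (λ i → sum (λ j → c i * (a j * V i j)))
        ≡⟨ sum-cong-≗ (λ i → sum-cong-≗ (λ j → swap (c i) (a j) (V i j))) ⟩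
      sum (λ i → sum (λ j → a j * (c i * V i j)))
        ≡⟨ ∑-comm (λ i j → a j * (c i * V i j)) ⟩
      sum (λ j → sum (λ i → a j * (c i * V i j)))
        ≡⟨ sum-cong-≗ (λ j → *-distribˡ-sum (a j) (λ i → c i * V i j)) ⟨
      sum (λ j → a j * sum (λ i → c i * V i j))
        ≡⟨ sum-zero (λ j → trans (cong (a j *_) (relation j)) (*-zeroʳ (a j))) ⟩
      0ℤ
        ∎
      where
      open ≡-Reasoning
      swap : ∀ x y z → x * (y * z) ≡ y * (x * z)
      swap = solve-∀

module Rauzy {A : Set} (_≟A_ : DecidableEquality A) where

  private
    _≟_ : DecidableEquality (List A)
    _≟_ = ≡-dec _≟A_

  open CycleSpace _≟_

  -- m is the length of the longest prefix of x ∷ w occurring in w, so s is the shortest one that does not.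
  module NewPrefix (x : A) (w : List A) where

    Occurs : ℕ → Set
    Occurs ℓ = Factor (take ℓ (x ∷ w)) w

    private
      whole-new : ¬ Occurs (suc (length w))
      whole-new x∷w⊑w =
        1+n≰n (factor-length (subst (λ v → Factor (x ∷ v) w) (take-all (length w) w ≤-refl) x∷w⊑w))

      threshold-found : ∃ λ m → Occurs m × ¬ Occurs (suc m)
      threshold-found = threshold (λ ℓ → factor? _≟A_ (take ℓ (x ∷ w)) w) (factor-[] w) whole-new

    m : ℕ
    m = proj₁ threshold-found

    s : List A
    s = take (suc m) (x ∷ w)

    s-new : ¬ Factor s w
    s-new = proj₂ (proj₂ threshold-found)

    s-prefix : s ++ drop (suc m) (x ∷ w) ≡ x ∷ w
    s-prefix = take++drop≡id (suc m) (x ∷ w)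

    s-arc : IsArc (x ∷ w) s
    s-arc = prefix⇒factor s-prefix , λ ()

    occurs⇒≤m : ∀ {ℓ} → Occurs ℓ → ℓ ≤ m
    occurs⇒≤m {ℓ} occurs with ℓ ≤? m
    ... | yes ℓ≤m = ℓ≤m
    ... | no  ℓ≰m = ⊥-elim (s-new (factor-trans (take-factor (≰⇒> ℓ≰m) (x ∷ w)) occurs))

    ≤m⇒occurs : ∀ {ℓ} → ℓ ≤ m → Occurs ℓ
    ≤m⇒occurs ℓ≤m = factor-trans (take-factor ℓ≤m (x ∷ w)) (proj₁ (proj₂ threshold-found))

    prefix-old⇒short : ∀ {u r} → u ++ r ≡ x ∷ w → Factor u w → length u ≤ m
    prefix-old⇒short u-prefix u-old = occurs⇒≤m (subst (λ v → Factor v w) (prefix-take u-prefix) u-old)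

    prefix-new⇒long : ∀ {u r} → u ++ r ≡ x ∷ w → ¬ Factor u w → suc m ≤ length u
    prefix-new⇒long {u} u-prefix u-new with length u ≤? m
    ... | yes short = ⊥-elim (u-new (subst (λ v → Factor v w) (sym (prefix-take u-prefix)) (≤m⇒occurs short)))
    ... | no  long  = ≰⇒> long

    src-s-old : Factor (src s) w
    src-s-old with _ , src-s-prefix ← src-prefix {u = s} s-prefix =
      subst (λ v → Factor v w) (sym (prefix-take src-s-prefix)) (≤m⇒occurs |src-s|≤m)
      where
      |src-s|≤m : length (src s) ≤ m
      |src-s|≤m = ≤-trans (≤-reflexive (trans (length-src≡length-tgt s) (length-take m w)))
                          (m⊓n≤m m (length w))

    new-arc-prefix : ∀ {u} → IsArc (x ∷ w) u → ¬ Factor u w → ∃ λ r → u ++ r ≡ x ∷ w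
    new-arc-prefix (u⊑x∷w , _) u-new with factor-∷⁻ u⊑x∷w
    ... | inj₁ u-old    = ⊥-elim (u-new u-old)
    ... | inj₂ u-prefix = u-prefix

    new-arc-tgt : ∀ {u} → IsArc (x ∷ w) u → ¬ Factor u w → tgt u ≡ take (length (src u)) w
    new-arc-tgt {u} u-arc u-new = prefix-∷-tgt {u = u} (proj₂ (new-arc-prefix u-arc u-new))

    new-arc-src-new : ∀ {u} → IsArc (x ∷ w) u → ¬ Factor u w → u ≢ s → ¬ Factor (src u) w
    new-arc-src-new {u} u-arc u-new u≢s src-old with _ , u-prefix ← new-arc-prefix u-arc u-new =
      u≢s (trans (prefix-take u-prefix) (cong (λ ℓ → take ℓ (x ∷ w)) |u|≡1+m))
      where
      |u|≡1+m : length u ≡ suc m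
      |u|≡1+m = ≤-antisym
        (≤-trans (≤-reflexive (length-src (proj₂ u-arc)))
                 (s≤s (prefix-old⇒short (proj₂ (src-prefix {u = u} u-prefix)) src-old)))
        (prefix-new⇒long u-prefix u-new)

    new-arc-src-injective : ∀ {u v} → IsArc (x ∷ w) u → ¬ Factor u w → IsArc (x ∷ w) v → ¬ Factor v w →
                      src u ≡ src v → u ≡ v
    new-arc-src-injective {u} {v} u-arc u-new v-arc v-new src-u≡src-v = begin
      u                        ≡⟨ prefix-take (proj₂ (new-arc-prefix u-arc u-new)) ⟩
      take (length u) (x ∷ w)  ≡⟨ cong (λ ℓ → take ℓ (x ∷ w)) |u|≡|v| ⟩
      take (length v) (x ∷ w)  ≡⟨ prefix-take (proj₂ (new-arc-prefix v-arc v-new)) ⟨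
      v                        ∎
      where
      open ≡-Reasoning
      |u|≡|v| : length u ≡ length v
      |u|≡|v| = trans (length-src (proj₂ u-arc))
                      (trans (cong (suc ∘ length) src-u≡src-v) (sym (length-src (proj₂ v-arc))))

    closingPath : ∃ λ st → Chain (tgt s) st (src s) × ArcsIn w st
    closingPath with st , chain , arcs ← prefixChain w src-s-old =
      st , subst (λ v → Chain v st (src s)) (sym (prefix-∷-tgt {u = s} s-prefix)) chain , arcs

    s-cycle : Cycle (x ∷ w)
    s-cycle = record
      { start   = src s
      ; startOK = factor-∷ src-s-old
      ; steps   = (s , true) ∷ proj₁ closingPath
      ; arcsOK  = s-arc ∷ arcsIn-∷ (proj₂ (proj₂ closingPath))
      ; closed  = refl , proj₁ (proj₂ closingPath)
      }

    μ-s-cycle-s : μ _≟_ s-cycle s ≡ 1ℤ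
    μ-s-cycle-s = begin
      count _≟_ s ((s , true) ∷ path)   ≡⟨ count-first s path ⟩
      1ℤ + count _≟_ s path             ≡⟨ cong (1ℤ +_) (count-absent (proj₂ (proj₂ closingPath)) s-new) ⟩
      1ℤ                                ∎
      where
      open ≡-Reasoning
      path = proj₁ closingPath

    -- A new vertex y is the source of exactly one new arc, whose target is take (length y) w;
    -- copying g across that arc makes δ vanish on it.
    extend : (List A → ℤ) → List A → ℤ
    extend g y with factor? _≟A_ y w
    ... | yes _ = g y
    ... | no  _ = g (take (length y) w)

    extend-old : (g : List A → ℤ) {y : List A} → Factor y w → extend g y ≡ g y
    extend-old g {y} y-old with factor? _≟A_ y w
    ... | yes _     = refl
    ... | no  y-new = ⊥-elim (y-new y-old)

    extend-new : (g : List A → ℤ) {y : List A} → ¬ Factor y w → extend g y ≡ g (take (length y) w)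
    extend-new g {y} y-new with factor? _≟A_ y w
    ... | yes y-old = ⊥-elim (y-new y-old)
    ... | no  _     = refl

    δ-extend-old-ends : (g : List A → ℤ) {v : List A} → Factor (src v) w → Factor (tgt v) w →
                        δ (extend g) v ≡ δ g v
    δ-extend-old-ends g src-old tgt-old = cong₂ _-_ (extend-old g src-old) (extend-old g tgt-old)

    δ-extend-pendant : (g : List A → ℤ) {v : List A} → IsArc (x ∷ w) v → ¬ Factor v w → v ≢ s →
                       δ (extend g) v ≡ 0ℤ
    δ-extend-pendant g {v} v-arc v-new v≢s = begin
      extend g (src v) - extend g (tgt v)
        ≡⟨ cong₂ _-_ (extend-new g (new-arc-src-new v-arc v-new v≢s))
                     (extend-old g (tgt-factor-∷ (proj₁ v-arc))) ⟩
      g (take (length (src v)) w) - g (tgt v)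
        ≡⟨ cong (λ y → g y - g (tgt v)) (new-arc-tgt v-arc v-new) ⟨
      g (tgt v) - g (tgt v)
        ≡⟨ +-inverseʳ (g (tgt v)) ⟩
      0ℤ
        ∎
      where open ≡-Reasoning

    data ArcKind (v : List A) : Set where
      old     : Factor v w → ArcKind v
      shortest  : v ≡ s → ArcKind v
      pendant : ¬ Factor v w → v ≢ s → ArcKind v

    arcKind : (v : List A) → ArcKind v
    arcKind v with factor? _≟A_ v w | v ≟ s
    ... | yes v-old | _        = old v-old
    ... | no  _     | yes v≡s  = shortest v≡s
    ... | no  v-new | no  v≢s  = pendant v-new v≢s

    module _ {n : ℕ} {B : Fin n → List A} (B-old : ∀ j → Factor (B j) w) where

      sum-B-new≡0 : (a : Fin n → ℤ) {v : List A} → ¬ Factor v w → sum (λ j → a j * 𝟙 (B j) v) ≡ 0ℤ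
      sum-B-new≡0 a {v} v-new = sum-zero λ j → trans (cong (a j *_) (𝟙-≢ (Bⱼ≢v j))) (*-zeroʳ (a j))
        where
        Bⱼ≢v : ∀ j → B j ≢ v
        Bⱼ≢v j Bⱼ≡v = v-new (subst (λ y → Factor y w) Bⱼ≡v (B-old j))

      old-arc-decomposition : {u : List A} → Factor u w → Decomposition w B u →
                              Decomposition (x ∷ w) (s Vector.∷ B) u
      old-arc-decomposition {u} u-old (a , g , 𝟙ᵤ≡) = c Vector.∷ a , extend g , 𝟙ᵤ≡′
        where
        -- c cancels δ (extend g) s; on the other new arcs δ (extend g) vanishes
        c : ℤ
        c = - δ g s

        𝟙ᵤ-new : ∀ {v} → ¬ Factor v w → 𝟙 u v ≡ 0ℤ
        𝟙ᵤ-new v-new = 𝟙-≢ (λ u≡v → v-new (subst (λ y → Factor y w) u≡v u-old))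

        𝟙ₛ-old : ∀ {v} → Factor v w → 𝟙 s v ≡ 0ℤ
        𝟙ₛ-old v-old = 𝟙-≢ (λ s≡v → s-new (subst (λ y → Factor y w) (sym s≡v) v-old))

        cong-terms : ∀ {i i′ S S′ d d′} → i ≡ i′ → S ≡ S′ → d ≡ d′ → c * i + S + d ≡ c * i′ + S′ + d′
        cong-terms refl refl refl = refl

        𝟙ᵤ≡′ : ∀ v → IsArc (x ∷ w) v →
               𝟙 u v ≡ c * 𝟙 s v + sum (λ j → a j * 𝟙 (B j) v) + δ (extend g) v
        𝟙ᵤ≡′ v v-arc@(_ , v≢[]) with arcKind v
        ... | old v-old = begin
          𝟙 u v                                              ≡⟨ 𝟙ᵤ≡ v (v-old , v≢[]) ⟩
          sum (λ j → a j * 𝟙 (B j) v) + δ g v                 ≡⟨ add-zero c _ _ ⟩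
          c * 0ℤ + sum (λ j → a j * 𝟙 (B j) v) + δ g v
            ≡⟨ cong-terms (𝟙ₛ-old v-old) refl (δ-extend-old-ends g (factor-src v-old) (factor-tgt v-old)) ⟨
          c * 𝟙 s v + sum (λ j → a j * 𝟙 (B j) v) + δ (extend g) v ∎
          where
          open ≡-Reasoning
          add-zero : ∀ c S d → S + d ≡ c * 0ℤ + S + d
          add-zero = solve-∀
        ... | shortest refl = begin
          𝟙 u s                                         ≡⟨ 𝟙ᵤ-new s-new ⟩
          0ℤ                                            ≡⟨ cancel (δ g s) ⟩
          c * 1ℤ + 0ℤ + δ g s
            ≡⟨ cong-terms (𝟙-refl s) (sum-B-new≡0 a s-new)
                          (δ-extend-old-ends g src-s-old (tgt-factor-∷ (proj₁ s-arc))) ⟨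
          c * 𝟙 s s + sum (λ j → a j * 𝟙 (B j) s) + δ (extend g) s ∎
          where
          open ≡-Reasoning
          cancel : ∀ d → 0ℤ ≡ - d * 1ℤ + 0ℤ + d
          cancel = solve-∀
        ... | pendant v-new v≢s = begin
          𝟙 u v                                          ≡⟨ 𝟙ᵤ-new v-new ⟩
          0ℤ                                             ≡⟨ annihilate c ⟩
          c * 0ℤ + 0ℤ + 0ℤ
            ≡⟨ cong-terms (𝟙-≢ (v≢s ∘ sym)) (sum-B-new≡0 a v-new) (δ-extend-pendant g v-arc v-new v≢s) ⟨
          c * 𝟙 s v + sum (λ j → a j * 𝟙 (B j) v) + δ (extend g) v ∎
          where
          open ≡-Reasoning
          annihilate : ∀ c → 0ℤ ≡ c * 0ℤ + 0ℤ + 0ℤ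
          annihilate = solve-∀

      s-decomposition : Decomposition (x ∷ w) (s Vector.∷ B) s
      s-decomposition = 1ℤ Vector.∷ const 0ℤ , const 0ℤ , λ v _ → begin
        𝟙 s v                                                   ≡⟨ pad (𝟙 s v) ⟩
        1ℤ * 𝟙 s v + 0ℤ + (0ℤ - 0ℤ)
          ≡⟨ cong (λ S → 1ℤ * 𝟙 s v + S + (0ℤ - 0ℤ)) (sum-zero (λ j → *-zeroˡ (𝟙 (B j) v))) ⟨
        1ℤ * 𝟙 s v + sum (λ j → 0ℤ * 𝟙 (B j) v) + (0ℤ - 0ℤ)   ∎
        where
        open ≡-Reasoning
        pad : ∀ i → i ≡ 1ℤ * i + 0ℤ + (0ℤ - 0ℤ)
        pad = solve-∀

      pendant-decomposition : {u : List A} → IsArc (x ∷ w) u → ¬ Factor u w → u ≢ s →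
                              Decomposition (x ∷ w) (s Vector.∷ B) u
      -- src u is a new vertex: u is the only arc leaving it and no arc enters it.
      pendant-decomposition {u} u-arc u-new u≢s = const 0ℤ , 𝟙 (src u) , λ v v-arc → begin
        𝟙 u v                                    ≡⟨ 𝟙-cong-⇔ (cong src) (src-injective v-arc) ⟩
        𝟙 (src u) (src v)                        ≡⟨ pad (𝟙 s v) (𝟙 (src u) (src v)) ⟩
        0ℤ * 𝟙 s v + 0ℤ + (𝟙 (src u) (src v) - 0ℤ)
          ≡⟨ cong₂ (λ S t → 0ℤ * 𝟙 s v + S + (𝟙 (src u) (src v) - t))
                   (sum-zero (λ j → *-zeroˡ (𝟙 (B j) v))) (𝟙-≢ (tgt-old v-arc)) ⟨
        0ℤ * 𝟙 s v + sum (λ j → 0ℤ * 𝟙 (B j) v) + (𝟙 (src u) (src v) - 𝟙 (src u) (tgt v)) ∎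
        where
        open ≡-Reasoning
        pad : ∀ a i → i ≡ 0ℤ * a + 0ℤ + (i - 0ℤ)
        pad = solve-∀

        src-u-new : ¬ Factor (src u) w
        src-u-new = new-arc-src-new u-arc u-new u≢s

        src-injective : ∀ {v} → IsArc (x ∷ w) v → src u ≡ src v → u ≡ v
        src-injective v-arc src-u≡src-v = new-arc-src-injective u-arc u-new v-arc
          (λ v-old → src-u-new (subst (λ y → Factor y w) (sym src-u≡src-v) (factor-src v-old)))
          src-u≡src-v

        tgt-old : ∀ {v} → IsArc (x ∷ w) v → src u ≢ tgt v
        tgt-old (v⊑x∷w , _) src-u≡tgt-v =
          src-u-new (subst (λ y → Factor y w) (sym src-u≡tgt-v) (tgt-factor-∷ v⊑x∷w))

      spans-∷ : Spans w B → Spans (x ∷ w) (s Vector.∷ B)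
      spans-∷ spans u u-arc with arcKind u
      ... | old u-old         = old-arc-decomposition u-old (spans u (u-old , proj₂ u-arc))
      ... | shortest refl       = s-decomposition
      ... | pendant u-new u≢s = pendant-decomposition u-arc u-new u≢s

  spanningArcs : (w : List A) → ∃ λ (B : Fin (length w) → List A) → (∀ j → Factor (B j) w) × Spans w B
  spanningArcs []      = (λ ()) , (λ ()) , λ _ u-arc → ⊥-elim (no-arc-[] u-arc)
  spanningArcs (x ∷ w) with B , B-old , spans ← spanningArcs w =
    s Vector.∷ B , B′-old , spans-∷ B-old spans
    where
    open NewPrefix x w
    B′-old : ∀ j → Factor ((s Vector.∷ B) j) (x ∷ w)
    B′-old zero    = proj₁ s-arc
    B′-old (suc j) = factor-∷ (B-old j)

  independentCycles : (w : List A) → Σ (Fin (length w) → Cycle w) (Independent _≟_)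
  independentCycles []      = (λ ()) , λ _ _ ()
  independentCycles (x ∷ w) with Z , Z-independent ← independentCycles w =
    s-cycle Vector.∷ (liftCycle ∘ Z) , independent
    where
    open NewPrefix x w
    independent : Independent _≟_ (s-cycle Vector.∷ (liftCycle ∘ Z))
    independent c combination≡0 = λ { zero → c₀≡0 ; (suc i) → Z-independent (c ∘ suc) rest≡0 i }
      where
      rest : List A → ℤ
      rest u = sumFin (length w) (λ i → c (suc i) * μ _≟_ (Z i) u)

      c₀≡0 : c zero ≡ 0ℤ
      c₀≡0 = begin
        c zero                                ≡⟨ pad (c zero) ⟩
        c zero * 1ℤ + 0ℤ                      ≡⟨ cong₂ (λ μₛ r → c zero * μₛ + r) μ-s-cycle-s
                                                       (sumFin-zero (length w) old-cycles-avoid-s) ⟨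
        c zero * μ _≟_ s-cycle s + rest s      ≡⟨ combination≡0 s s-arc ⟩
        0ℤ                                    ∎
        where
        open ≡-Reasoning
        pad : ∀ i → i ≡ i * 1ℤ + 0ℤ
        pad = solve-∀

        old-cycles-avoid-s : ∀ i → c (suc i) * μ _≟_ (Z i) s ≡ 0ℤ
        old-cycles-avoid-s i =
          trans (cong (c (suc i) *_) (count-absent (arcsOK (Z i)) s-new)) (*-zeroʳ (c (suc i)))

      rest≡0 : ∀ u → IsArc w u → rest u ≡ 0ℤ
      rest≡0 u (u⊑w , u≢[]) = begin
        rest u                                ≡⟨ +-identityˡ (rest u) ⟨
        0ℤ + rest u                           ≡⟨ cong (_+ rest u) (trans (cong (_* μₛ) c₀≡0) (*-zeroˡ μₛ)) ⟨
        c zero * μₛ + rest u                  ≡⟨ combination≡0 u (factor-∷ u⊑w , u≢[]) ⟩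
        0ℤ                                    ∎
        where
        open ≡-Reasoning
        μₛ = μ _≟_ s-cycle u

lemma2 : {A : Set} (_≟_ : DecidableEquality A) (w : List A) →
         Σ (Fin (length w) → Cycle w) (Independent (≡-dec _≟_))
         × ((k : ℕ) (C : Fin k → Cycle w) → Independent (≡-dec _≟_) C → k ≤ length w)
lemma2 _≟_ w = independentCycles w , independent≤spanning (proj₂ (proj₂ (spanningArcs w)))
  where
  open Rauzy _≟_
  open CycleSpace (≡-dec _≟_)
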